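{- Let $\rho:2^E\to\mathbb{Z}_+$ be monotone submodular with $\rho(\emptyset)=0$, let $P=\{\boldsymbol{x}\in\mathbb{R}_+^E:\boldsymbol{x}(X)\le\rho(X)\ \forall X\subseteq E\}$ and $B=\{\boldsymbol{x}\in P:\boldsymbol{x}(E)=\rho(E)\}$. Let $\boldsymbol{x},\boldsymbol{y}\in B\cap\mathbb{Z}_+^E$ and $I(\boldsymbol{x}):=\{(e,i):e\in\mathrm{supp}^+(\boldsymbol{x}),\ 1\le i\le\boldsymbol{x}(e)\}$. Then there exists a map $\phi:I(\boldsymbol{x})\to\mathrm{supp}^+(\boldsymbol{y})$ such that $\boldsymbol{x}-\boldsymbol{\chi}_e+\boldsymbol{\chi}_{\phi(e,i)}\in B\cap\mathbb{Z}_+^E$ for each $e\in\mathrm{supp}^+(\boldsymbol{x})$ and $1\le i\le\boldsymbol{x}(e)$, and $\boldsymbol{y}=\sum_{(e,i)\in I(\boldsymbol{x})}\boldsymbol{\chi}_{\phi(e,i)}$.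
   Context: $\boldsymbol{x}(X)=\sum_{i\in X}\boldsymbol{x}(i)$; $\mathrm{supp}^+(\boldsymbol{x})=\{e\in E:\boldsymbol{x}(e)>0\}$; $\boldsymbol{\chi}_e$ is the $e$-th unit vector. -}

module Defs where

open import Data.Nat using (ℕ; zero; suc; _+_; _∸_; _≤_)
open import Data.Fin using (Fin; zero; suc; _≟_)
open import Data.Fin.Subset using (Subset; _⊆_; _∪_; _∩_; ⊥; ⊤)
open import Data.Vec using (lookup)
open import Data.Bool using (if_then_else_)
open import Relation.Nullary.Decidable using (does)
open import Relation.Binary.PropositionalEquality using (_≡_)
open import Data.Product using (_×_)

Σᶠ : (m : ℕ) → (Fin m → ℕ) → ℕ
Σᶠ zero    f = 0
Σᶠ (suc m) f = f zero + Σᶠ m (λ i → f (suc i))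

_⟨_⟩ : {n : ℕ} → (Fin n → ℕ) → Subset n → ℕ
_⟨_⟩ {n} x X = Σᶠ n (λ i → if lookup X i then x i else 0)

χ : {n : ℕ} → Fin n → Fin n → ℕ
χ e k = if does (k ≟ e) then 1 else 0

Monotone : {n : ℕ} → (Subset n → ℕ) → Set
Monotone ρ = ∀ X Y → X ⊆ Y → ρ X ≤ ρ Y

Submodular : {n : ℕ} → (Subset n → ℕ) → Set
Submodular ρ = ∀ X Y → ρ (X ∪ Y) + ρ (X ∩ Y) ≤ ρ X + ρ Y

InBZ : {n : ℕ} → (Subset n → ℕ) → (Fin n → ℕ) → Set
InBZ ρ x = (∀ X → x ⟨ X ⟩ ≤ ρ X) × (x ⟨ ⊤ ⟩ ≡ ρ ⊤)

-- x - χ_e + χ_f (only used when x(e) ≥ 1, so truncated subtraction is exact)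
exch : {n : ℕ} → (Fin n → ℕ) → Fin n → Fin n → Fin n → ℕ
exch x e f k = (x k ∸ χ e k) + χ f k

-- Call e → f an edge when x − χ_e + χ_f ∈ B, and let N F be the set of e with an edge into
-- F.  Splitting rows into unit vectors, a map φ as required is the same as a nonnegative
-- integer matrix with row sums x and column sums y supported on edges, and by the multiset
-- form of Hall's theorem (induction on Σ y: split along a critical set, or else remove one
-- unit on an edge) such a matrix exists once y(F) ≤ x(N F) for all F.  If e ∈ supp⁺(x) has
-- no edge to f, some x-tight set contains f but not e; tight sets are closed under ∪ and ∩
-- by submodularity, so each F lies in a tight T with T ∩ supp⁺(x) ⊆ N F, whence
-- y(F) ≤ y(T) ≤ ρ(T) = x(T) ≤ x(N F).
module Submission where

open import Defs
open import Data.Bool using (true; false; if_then_else_; _∧_; _∨_)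
open import Data.Empty using (⊥-elim)
open import Data.Fin using (Fin; zero; suc; _≟_)
open import Data.Fin.Properties using (any?)
open import Data.Fin.Subset using (Subset; ⊥; ⊤; _∪_; _∩_; ∁; _∈_; _∉_; _⊆_; ⁅_⁆)
open import Data.Fin.Subset.Properties
  using ( _∈?_; ∈⊤; ∉⊥; ⊆⊤; x∈p⇒x∉∁p; x∉p⇒x∈∁p; x∈∁p⇒x∉p; x∈p∩q⁻; x∈p∩q⁺; x∈p∪q⁻; x∈p∪q⁺
        ; p⊆p∪q; q⊆p∪q; p∩q⊆p; p∩q⊆q; x∈⁅y⁆⇒x≡y; x∈⁅x⁆; anySubset?)
open import Data.Nat using (ℕ; zero; suc; _+_; _*_; _∸_; _<_; _≤_; z≤n; s≤s; z<s)
open import Data.Nat.Properties renaming (_≟_ to _≟ℕ_)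
open import Data.Nat.Induction using (<-rec)
open import Algebra.Properties.CommutativeSemigroup +-commutativeSemigroup
  using (interchange; xy∙z≈xz∙y)
open import Data.Product using (Σ; ∃; _×_; _,_; proj₁; proj₂)
open import Data.Sum using (_⊎_; inj₁; inj₂; [_,_])
open import Data.List using (List; []; _∷_; allFin)
open import Data.List.Membership.Propositional using () renaming (_∈_ to _∈ₗ_)
open import Data.List.Membership.Propositional.Properties using (∈-allFin)
open import Data.List.Relation.Unary.Any using (here; there)
open import Data.Vec using (lookup; tabulate)
open import Data.Vec.Properties using (lookup-zipWith; []=⇒lookup; lookup⇒[]=; lookup∘tabulate)
open import Relation.Binary.PropositionalEquality
  using (_≡_; _≢_; refl; sym; trans; cong; cong₂; subst; subst₂; module ≡-Reasoning)
open import Relation.Nullary using (Dec; yes; no; ¬_; does)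
open import Function using (_∘_)
open import Relation.Nullary.Decidable using (dec-true; dec-false; _×-dec_; ¬?; decidable-stable)

+-≤-squeeze : ∀ {u U v V} → u ≤ U → v ≤ V → U + V ≤ u + v → u ≡ U × v ≡ V
+-≤-squeeze {u} {U} {v} {V} u≤U v≤V UV≤uv =
  ≤-antisym u≤U (+-cancelʳ-≤ V U u (≤-trans UV≤uv (+-monoʳ-≤ u v≤V))) ,
  ≤-antisym v≤V (+-cancelˡ-≤ U V v (≤-trans UV≤uv (+-monoˡ-≤ v u≤U)))

Σᶠ-cong : ∀ m {f g : Fin m → ℕ} → (∀ i → f i ≡ g i) → Σᶠ m f ≡ Σᶠ m g
Σᶠ-cong zero    f≗g = refl
Σᶠ-cong (suc m) f≗g = cong₂ _+_ (f≗g zero) (Σᶠ-cong m (λ i → f≗g (suc i)))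

Σᶠ-mono-≤ : ∀ m {f g : Fin m → ℕ} → (∀ i → f i ≤ g i) → Σᶠ m f ≤ Σᶠ m g
Σᶠ-mono-≤ zero    f≤g = z≤n
Σᶠ-mono-≤ (suc m) f≤g = +-mono-≤ (f≤g zero) (Σᶠ-mono-≤ m (λ i → f≤g (suc i)))

Σᶠ-distrib-+ : ∀ m (f g : Fin m → ℕ) → Σᶠ m (λ i → f i + g i) ≡ Σᶠ m f + Σᶠ m g
Σᶠ-distrib-+ zero    f g = refl
Σᶠ-distrib-+ (suc m) f g =
  trans (cong (f zero + g zero +_) (Σᶠ-distrib-+ m (λ i → f (suc i)) (λ i → g (suc i))))
        (interchange (f zero) (g zero) _ _)

Σᶠ-*ˡ : ∀ m c (f : Fin m → ℕ) → Σᶠ m (λ i → c * f i) ≡ c * Σᶠ m f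
Σᶠ-*ˡ zero    c f = sym (*-zeroʳ c)
Σᶠ-*ˡ (suc m) c f =
  trans (cong (c * f zero +_) (Σᶠ-*ˡ m c (λ i → f (suc i)))) (sym (*-distribˡ-+ c (f zero) _))

Σᶠ-*ʳ : ∀ m c (f : Fin m → ℕ) → Σᶠ m (λ i → f i * c) ≡ Σᶠ m f * c
Σᶠ-*ʳ m c f = trans (Σᶠ-cong m (λ i → *-comm (f i) c)) (trans (Σᶠ-*ˡ m c f) (*-comm c _))

Σᶠ-zero : ∀ m → Σᶠ m (λ _ → 0) ≡ 0
Σᶠ-zero zero    = refl
Σᶠ-zero (suc m) = Σᶠ-zero m

term≤Σᶠ : ∀ m (f : Fin m → ℕ) i → f i ≤ Σᶠ m f
term≤Σᶠ (suc m) f zero    = m≤m+n (f zero) _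
term≤Σᶠ (suc m) f (suc i) = ≤-trans (term≤Σᶠ m (λ j → f (suc j)) i) (m≤n+m _ (f zero))

Σᶠ≡0⇒≡0 : ∀ m (f : Fin m → ℕ) → Σᶠ m f ≡ 0 → ∀ i → f i ≡ 0
Σᶠ≡0⇒≡0 m f Σf≡0 i = n≤0⇒n≡0 (subst (f i ≤_) Σf≡0 (term≤Σᶠ m f i))

Σᶠ-pos : ∀ m (f : Fin m → ℕ) → 0 < Σᶠ m f → ∃ λ i → 0 < f i
Σᶠ-pos (suc m) f Σf>0 with f zero in f₀≡
... | suc _ = zero , subst (0 <_) (sym f₀≡) (s≤s z≤n)
... | zero  with Σᶠ-pos m (λ i → f (suc i)) Σf>0
...   | i , fᵢ>0 = suc i , fᵢ>0

χ-≢ : ∀ {n} (e i : Fin n) → i ≢ e → χ e i ≡ 0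
χ-≢ e i i≢e rewrite dec-false (i ≟ e) i≢e = refl

Σᶠ-χ : ∀ m (e : Fin m) → Σᶠ m (χ e) ≡ 1
Σᶠ-χ (suc m) zero    = cong suc (Σᶠ-zero m)
Σᶠ-χ (suc m) (suc e) = Σᶠ-χ m e

_∸χ_ : ∀ {n} → (Fin n → ℕ) → Fin n → Fin n → ℕ
(v ∸χ e) i = v i ∸ χ e i

∸χ+χ : ∀ {n} (v : Fin n → ℕ) {e} → 1 ≤ v e → ∀ i → (v ∸χ e) i + χ e i ≡ v i
∸χ+χ v {e} vₑ>0 i with i ≟ e
... | yes refl = m∸n+n≡m vₑ>0
... | no  _    = +-identityʳ (v i)

restrict : ∀ {n} → Subset n → (Fin n → ℕ) → Fin n → ℕ
restrict X v i = if lookup X i then v i else 0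

restrict-∈ : ∀ {n} {X : Subset n} {i} v → i ∈ X → restrict X v i ≡ v i
restrict-∈ v i∈X rewrite []=⇒lookup i∈X = refl

restrict-∉ : ∀ {n} {X : Subset n} {i} v → i ∉ X → restrict X v i ≡ 0
restrict-∉ {X = X} {i} v i∉X with lookup X i in eq
... | true  = ⊥-elim (i∉X (lookup⇒[]= i X eq))
... | false = refl

restrict≤ : ∀ {n} (X : Subset n) v i → restrict X v i ≤ v i
restrict≤ X v i with lookup X i
... | true  = ≤-refl
... | false = z≤n

restrict-pos⇒∈ : ∀ {n} (X : Subset n) v {i} → 0 < restrict X v i → i ∈ X
restrict-pos⇒∈ X v {i} pos with i ∈? X
... | yes i∈X = i∈X
... | no  i∉X = ⊥-elim (<-irrefl (sym (restrict-∉ v i∉X)) pos)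

restrict+restrict∁ : ∀ {n} (F : Subset n) v i → restrict F v i + restrict (∁ F) v i ≡ v i
restrict+restrict∁ F v i with i ∈? F
... | yes i∈F rewrite restrict-∈ v i∈F | restrict-∉ v (x∈p⇒x∉∁p i∈F) = +-identityʳ (v i)
... | no  i∉F rewrite restrict-∉ v i∉F | restrict-∈ v (x∉p⇒x∈∁p i∉F) = refl

module _ {n : ℕ} where

  ⟨⟩-cong : ∀ {v w : Fin n → ℕ} X → (∀ i → v i ≡ w i) → v ⟨ X ⟩ ≡ w ⟨ X ⟩
  ⟨⟩-cong X v≗w = Σᶠ-cong n (λ i → cong (λ t → if lookup X i then t else 0) (v≗w i))

  ⟨⊤⟩ : ∀ v → v ⟨ ⊤ ⟩ ≡ Σᶠ n v
  ⟨⊤⟩ v = Σᶠ-cong n (λ i → restrict-∈ {i = i} v ∈⊤)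

  ⟨⊥⟩ : ∀ v → v ⟨ ⊥ ⟩ ≡ 0
  ⟨⊥⟩ v = trans (Σᶠ-cong n (λ i → restrict-∉ {X = ⊥} {i} v ∉⊥)) (Σᶠ-zero n)

  ⟨⟩-distrib-+ : ∀ v w X → (λ i → v i + w i) ⟨ X ⟩ ≡ v ⟨ X ⟩ + w ⟨ X ⟩
  ⟨⟩-distrib-+ v w X = trans (Σᶠ-cong n split) (Σᶠ-distrib-+ n (restrict X v) (restrict X w))
    where
    split : ∀ i → restrict X (λ j → v j + w j) i ≡ restrict X v i + restrict X w i
    split i with lookup X i
    ... | true  = refl
    ... | false = refl

  ⟨⟩-mono : ∀ v X w Y → (∀ {i} → i ∈ X → 0 < v i → i ∈ Y × v i ≤ w i) →
            v ⟨ X ⟩ ≤ w ⟨ Y ⟩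
  ⟨⟩-mono v X w Y h = Σᶠ-mono-≤ n pointwise
    where
    within : ∀ {i} → i ∈ X → v i ≤ restrict Y w i
    within {i} i∈X with 0 <? v i
    ... | no  vᵢ≯0 = subst (_≤ restrict Y w i) (sym (n≤0⇒n≡0 (≮⇒≥ vᵢ≯0))) z≤n
    ... | yes vᵢ>0 with h i∈X vᵢ>0
    ...   | i∈Y , vᵢ≤wᵢ = subst (v i ≤_) (sym (restrict-∈ w i∈Y)) vᵢ≤wᵢ

    pointwise : ∀ i → restrict X v i ≤ restrict Y w i
    pointwise i with i ∈? X
    ... | no  i∉X rewrite restrict-∉ v i∉X = z≤n
    ... | yes i∈X rewrite restrict-∈ v i∈X = within i∈X

  ⟨⟩-mono-⊆ : ∀ v {X Y} → X ⊆ Y → v ⟨ X ⟩ ≤ v ⟨ Y ⟩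
  ⟨⟩-mono-⊆ v {X} {Y} X⊆Y = ⟨⟩-mono v X v Y (λ i∈X _ → X⊆Y i∈X , ≤-refl)

  ⟨⟩-modular : ∀ v X Y → v ⟨ X ∪ Y ⟩ + v ⟨ X ∩ Y ⟩ ≡ v ⟨ X ⟩ + v ⟨ Y ⟩
  ⟨⟩-modular v X Y = trans (sym (Σᶠ-distrib-+ n _ _)) (trans (Σᶠ-cong n pointwise) (Σᶠ-distrib-+ n _ _))
    where
    pointwise : ∀ i → restrict (X ∪ Y) v i + restrict (X ∩ Y) v i ≡ restrict X v i + restrict Y v i
    pointwise i rewrite lookup-zipWith _∨_ i X Y | lookup-zipWith _∧_ i X Y
      with lookup X i | lookup Y i
    ... | true  | true  = refl
    ... | true  | false = refl
    ... | false | true  = +-identityʳ (v i)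
    ... | false | false = refl

  ⟨⟩-split : ∀ v F X → v ⟨ X ⟩ ≡ restrict F v ⟨ X ⟩ + restrict (∁ F) v ⟨ X ⟩
  ⟨⟩-split v F X =
    trans (⟨⟩-cong X (λ i → sym (restrict+restrict∁ F v i))) (⟨⟩-distrib-+ _ _ X)

  Σᶠ-split : ∀ v F → Σᶠ n v ≡ v ⟨ F ⟩ + v ⟨ ∁ F ⟩
  Σᶠ-split v F =
    trans (Σᶠ-cong n (λ i → sym (restrict+restrict∁ F v i))) (Σᶠ-distrib-+ n _ _)

  χ⟨⟩-∈ : ∀ e {X} → e ∈ X → χ e ⟨ X ⟩ ≡ 1
  χ⟨⟩-∈ e {X} e∈X = trans (Σᶠ-cong n pointwise) (Σᶠ-χ n e)
    where
    pointwise : ∀ i → restrict X (χ e) i ≡ χ e i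
    pointwise i with i ∈? X
    ... | yes i∈X = restrict-∈ (χ e) i∈X
    ... | no  i∉X = trans (restrict-∉ (χ e) i∉X) (sym (χ-≢ e i λ { refl → i∉X e∈X }))

  χ⟨⟩-∉ : ∀ e {X} → e ∉ X → χ e ⟨ X ⟩ ≡ 0
  χ⟨⟩-∉ e {X} e∉X = trans (Σᶠ-cong n pointwise) (Σᶠ-zero n)
    where
    pointwise : ∀ i → restrict X (χ e) i ≡ 0
    pointwise i with i ∈? X
    ... | yes i∈X = trans (restrict-∈ (χ e) i∈X) (χ-≢ e i λ { refl → e∉X i∈X })
    ... | no  i∉X = restrict-∉ (χ e) i∉X

  χ⟨⟩≤1 : ∀ e X → χ e ⟨ X ⟩ ≤ 1
  χ⟨⟩≤1 e X with e ∈? X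
  ... | yes e∈X = ≤-reflexive (χ⟨⟩-∈ e e∈X)
  ... | no  e∉X = subst (_≤ 1) (sym (χ⟨⟩-∉ e e∉X)) z≤n

  ⟨⟩-∸χ : ∀ v {e} → 1 ≤ v e → ∀ X → (v ∸χ e) ⟨ X ⟩ + χ e ⟨ X ⟩ ≡ v ⟨ X ⟩
  ⟨⟩-∸χ v vₑ>0 X = trans (sym (⟨⟩-distrib-+ _ _ X)) (⟨⟩-cong X (∸χ+χ v vₑ>0))

  ⟨⟩≤suc⟨⟩-∸χ : ∀ v {e} → 1 ≤ v e → ∀ X → v ⟨ X ⟩ ≤ suc ((v ∸χ e) ⟨ X ⟩)
  ⟨⟩≤suc⟨⟩-∸χ v {e} vₑ>0 X = begin
    v ⟨ X ⟩                         ≡⟨ sym (⟨⟩-∸χ v vₑ>0 X) ⟩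
    (v ∸χ e) ⟨ X ⟩ + χ e ⟨ X ⟩      ≤⟨ +-monoʳ-≤ ((v ∸χ e) ⟨ X ⟩) (χ⟨⟩≤1 e X) ⟩
    (v ∸χ e) ⟨ X ⟩ + 1              ≡⟨ +-comm _ 1 ⟩
    suc ((v ∸χ e) ⟨ X ⟩)            ∎
    where open ≤-Reasoning

  Σᶠ-∸χ : ∀ v {e} → 1 ≤ v e → suc (Σᶠ n (v ∸χ e)) ≡ Σᶠ n v
  Σᶠ-∸χ v {e} vₑ>0 = begin
    suc (Σᶠ n (v ∸χ e))             ≡⟨ +-comm 1 _ ⟩
    Σᶠ n (v ∸χ e) + 1               ≡⟨ cong₂ _+_ (sym (⟨⊤⟩ (v ∸χ e))) (sym (χ⟨⟩-∈ e ∈⊤)) ⟩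
    (v ∸χ e) ⟨ ⊤ ⟩ + χ e ⟨ ⊤ ⟩      ≡⟨ ⟨⟩-∸χ v vₑ>0 ⊤ ⟩
    v ⟨ ⊤ ⟩                         ≡⟨ ⟨⊤⟩ v ⟩
    Σᶠ n v                          ∎
    where open ≡-Reasoning

  exch-⟨⟩ : ∀ v {e} f → 1 ≤ v e → ∀ X → exch v e f ⟨ X ⟩ + χ e ⟨ X ⟩ ≡ v ⟨ X ⟩ + χ f ⟨ X ⟩
  exch-⟨⟩ v {e} f vₑ>0 X = begin
    exch v e f ⟨ X ⟩ + χ e ⟨ X ⟩                ≡⟨ cong (_+ χ e ⟨ X ⟩) (⟨⟩-distrib-+ (v ∸χ e) (χ f) X) ⟩
    (v ∸χ e) ⟨ X ⟩ + χ f ⟨ X ⟩ + χ e ⟨ X ⟩      ≡⟨ xy∙z≈xz∙y ((v ∸χ e) ⟨ X ⟩) _ _ ⟩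
    (v ∸χ e) ⟨ X ⟩ + χ e ⟨ X ⟩ + χ f ⟨ X ⟩      ≡⟨ cong (_+ χ f ⟨ X ⟩) (⟨⟩-∸χ v vₑ>0 X) ⟩
    v ⟨ X ⟩ + χ f ⟨ X ⟩                          ∎
    where open ≡-Reasoning

module _ {n : ℕ} {P : Fin n → Set} (P? : ∀ i → Dec (P i)) where

  subset : Subset n
  subset = tabulate (λ i → does (P? i))

  ∈subset⁺ : ∀ {i} → P i → i ∈ subset
  ∈subset⁺ {i} Pi = lookup⇒[]= i subset (trans (lookup∘tabulate _ i) (dec-true (P? i) Pi))

  ∈subset⁻ : ∀ {i} → i ∈ subset → P i
  ∈subset⁻ {i} i∈ with P? i | trans (sym (lookup∘tabulate (λ j → does (P? j)) i)) ([]=⇒lookup i∈)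
  ... | yes Pi | _  = Pi
  ... | no  _  | ()

module _ {n : ℕ} {P : Subset n → Set} where

  ∩-closed-avoiding : ∀ {Q : Fin n → Set} → (∀ i → Dec (Q i)) →
    P ⊤ → (∀ {X Y} → P X → P Y → P (X ∩ Y)) → (∀ {e} → Q e → ∃ λ X → P X × e ∉ X) →
    ∃ λ X → P X × (∀ {e} → Q e → e ∉ X)
  ∩-closed-avoiding {Q} Q? P⊤ P∩ separate =
    let X , PX , avoids = go (allFin n) in X , PX , λ {e} → avoids (∈-allFin e)
    where
    go : (L : List (Fin n)) → ∃ λ X → P X × (∀ {e} → e ∈ₗ L → Q e → e ∉ X)
    go []      = ⊤ , P⊤ , λ ()
    go (e ∷ L) with go L | Q? e
    ... | X , PX , avoids | no ¬Qe = X , PX , λ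
      { (here refl) Qe → ⊥-elim (¬Qe Qe)
      ; (there e′∈L)   → avoids e′∈L }
    ... | X , PX , avoids | yes Qe with separate Qe
    ...   | Y , PY , e∉Y = X ∩ Y , P∩ PX PY , λ
      { (here refl) _ e∈X∩Y  → e∉Y (proj₂ (x∈p∩q⁻ X Y e∈X∩Y))
      ; (there e′∈L) Qe′ e′∈X∩Y → avoids e′∈L Qe′ (proj₁ (x∈p∩q⁻ X Y e′∈X∩Y)) }

  ∪-closed-covering : ∀ F → P ⊥ → (∀ {X Y} → P X → P Y → P (X ∪ Y)) →
    (∀ {f} → f ∈ F → ∃ λ X → P X × f ∈ X) → ∃ λ T → P T × F ⊆ T
  ∪-closed-covering F P⊥ P∪ cover =
    let T , PT , covers = go (allFin n) in T , PT , λ {f} → covers (∈-allFin f)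
    where
    go : (L : List (Fin n)) → ∃ λ T → P T × (∀ {f} → f ∈ₗ L → f ∈ F → f ∈ T)
    go []      = ⊥ , P⊥ , λ ()
    go (f ∷ L) with go L | f ∈? F
    ... | T , PT , covers | no f∉F = T , PT , λ
      { (here refl) f∈F → ⊥-elim (f∉F f∈F)
      ; (there f′∈L)    → covers f′∈L }
    ... | T , PT , covers | yes f∈F with cover f∈F
    ...   | X , PX , f∈X = T ∪ X , P∪ PT PX , λ
      { (here refl) _        → x∈p∪q⁺ (inj₂ f∈X)
      ; (there f′∈L) f′∈F → x∈p∪q⁺ (inj₁ (covers f′∈L f′∈F)) }

module Transportation {n : ℕ} (R : Fin n → Fin n → Set) (R? : ∀ e f → Dec (R e f)) where

  adjacent? : ∀ F e → Dec (∃ λ f → f ∈ F × R e f)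
  adjacent? F e = any? (λ f → (f ∈? F) ×-dec R? e f)

  N : Subset n → Subset n
  N F = subset (adjacent? F)

  ∈N⁺ : ∀ {F e f} → f ∈ F → R e f → e ∈ N F
  ∈N⁺ {F} f∈F r = ∈subset⁺ (adjacent? F) (_ , f∈F , r)

  ∈N⁻ : ∀ {F e} → e ∈ N F → ∃ λ f → f ∈ F × R e f
  ∈N⁻ {F} = ∈subset⁻ (adjacent? F)

  N-mono : ∀ {F G} → F ⊆ G → N F ⊆ N G
  N-mono F⊆G e∈NF = let _ , f∈F , r = ∈N⁻ e∈NF in ∈N⁺ (F⊆G f∈F) r

  N-∪ : ∀ {F G e} → e ∈ N (F ∪ G) → e ∈ N F ⊎ e ∈ N G
  N-∪ {F} {G} e∈N with ∈N⁻ e∈N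
  ... | f , f∈F∪G , r with x∈p∪q⁻ F G f∈F∪G
  ...   | inj₁ f∈F = inj₁ (∈N⁺ f∈F r)
  ...   | inj₂ f∈G = inj₂ (∈N⁺ f∈G r)

  HallCondition : (a b : Fin n → ℕ) → Set
  HallCondition a b = ∀ F → b ⟨ F ⟩ ≤ a ⟨ N F ⟩

  record Transport (a b : Fin n → ℕ) : Set where
    field
      M          : Fin n → Fin n → ℕ
      row-sum    : ∀ e → Σᶠ n (M e) ≡ a e
      column-sum : ∀ f → Σᶠ n (λ e → M e f) ≡ b f
      supported  : ∀ e f → 0 < M e f → R e f

  open Transport

  transport-zero : ∀ {a b} → (∀ e → a e ≡ 0) → (∀ f → b f ≡ 0) → Transport a b
  transport-zero a≡0 b≡0 = record
    { M          = λ _ _ → 0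
    ; row-sum    = λ e → trans (Σᶠ-zero n) (sym (a≡0 e))
    ; column-sum = λ f → trans (Σᶠ-zero n) (sym (b≡0 f))
    ; supported  = λ _ _ ()
    }

  transport-unit : ∀ {e f} → R e f → Transport (χ e) (χ f)
  transport-unit {e} {f} r = record
    { M          = λ e′ f′ → χ e e′ * χ f f′
    ; row-sum    = λ e′ → trans (Σᶠ-*ˡ n (χ e e′) (χ f)) (trans (cong (χ e e′ *_) (Σᶠ-χ n f)) (*-identityʳ _))
    ; column-sum = λ f′ → trans (Σᶠ-*ʳ n (χ f f′) (χ e)) (trans (cong (_* χ f f′) (Σᶠ-χ n e)) (*-identityˡ _))
    ; supported  = supported′
    }
    where
    supported′ : ∀ e′ f′ → 0 < χ e e′ * χ f f′ → R e′ f′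
    supported′ e′ f′ pos with e′ ≟ e | f′ ≟ f
    ... | yes refl | yes refl = r
    ... | no  _    | _        = ⊥-elim (<-irrefl refl pos)
    ... | yes _    | no  _    = ⊥-elim (<-irrefl refl pos)

  _⊕_ : ∀ {a₁ b₁ a₂ b₂} → Transport a₁ b₁ → Transport a₂ b₂ →
        Transport (λ e → a₁ e + a₂ e) (λ f → b₁ f + b₂ f)
  T₁ ⊕ T₂ = record
    { M          = λ e f → M T₁ e f + M T₂ e f
    ; row-sum    = λ e → trans (Σᶠ-distrib-+ n _ _) (cong₂ _+_ (row-sum T₁ e) (row-sum T₂ e))
    ; column-sum = λ f → trans (Σᶠ-distrib-+ n _ _) (cong₂ _+_ (column-sum T₁ f) (column-sum T₂ f))
    ; supported  = supported′
    }
    where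
    supported′ : ∀ e f → 0 < M T₁ e f + M T₂ e f → R e f
    supported′ e f pos with M T₁ e f in M₁≡
    ... | zero  = supported T₂ e f pos
    ... | suc _ = supported T₁ e f (subst (0 <_) (sym M₁≡) z<s)

  transport-cast : ∀ {a b a′ b′} → (∀ e → a e ≡ a′ e) → (∀ f → b f ≡ b′ f) →
                   Transport a b → Transport a′ b′
  transport-cast a≗a′ b≗b′ T = record
    { M          = M T
    ; row-sum    = λ e → trans (row-sum T e) (a≗a′ e)
    ; column-sum = λ f → trans (column-sum T f) (b≗b′ f)
    ; supported  = supported T
    }

  Critical : (a b : Fin n → ℕ) → Subset n → Set
  Critical a b F = 0 < b ⟨ F ⟩ × b ⟨ F ⟩ < Σᶠ n b × a ⟨ N F ⟩ ≤ b ⟨ F ⟩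

  critical? : ∀ a b F → Dec (Critical a b F)
  critical? a b F = (0 <? b ⟨ F ⟩) ×-dec (b ⟨ F ⟩ <? Σᶠ n b) ×-dec (a ⟨ N F ⟩ ≤? b ⟨ F ⟩)

  Smaller : (Fin n → ℕ) → Set
  Smaller b = ∀ {a′ b′} → Σᶠ n b′ < Σᶠ n b → Σᶠ n a′ ≡ Σᶠ n b′ → HallCondition a′ b′ → Transport a′ b′

  split-at-critical : ∀ {a b F} → Smaller b → Σᶠ n a ≡ Σᶠ n b → HallCondition a b →
                      Critical a b F → Transport a b
  split-at-critical {a} {b} {F} smaller balanced hall (b⟨F⟩>0 , b⟨F⟩<Σb , a⟨NF⟩≤b⟨F⟩) =
    transport-cast (restrict+restrict∁ (N F) a) (restrict+restrict∁ F b)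
      (smaller b⟨F⟩<Σb inner-balanced inner-hall ⊕ smaller outer-smaller outer-balanced outer-hall)
    where
    a₁ a₂ b₁ b₂ : Fin n → ℕ
    a₁ = restrict (N F) a
    a₂ = restrict (∁ (N F)) a
    b₁ = restrict F b
    b₂ = restrict (∁ F) b

    inner-balanced : a ⟨ N F ⟩ ≡ b ⟨ F ⟩
    inner-balanced = ≤-antisym a⟨NF⟩≤b⟨F⟩ (hall F)

    outer-balanced : a ⟨ ∁ (N F) ⟩ ≡ b ⟨ ∁ F ⟩
    outer-balanced = +-cancelˡ-≡ (b ⟨ F ⟩) _ _ (begin
      b ⟨ F ⟩ + a ⟨ ∁ (N F) ⟩      ≡⟨ cong (_+ a ⟨ ∁ (N F) ⟩) inner-balanced ⟨
      a ⟨ N F ⟩ + a ⟨ ∁ (N F) ⟩    ≡⟨ Σᶠ-split a (N F) ⟨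
      Σᶠ n a                       ≡⟨ balanced ⟩
      Σᶠ n b                       ≡⟨ Σᶠ-split b F ⟩
      b ⟨ F ⟩ + b ⟨ ∁ F ⟩          ∎)
      where open ≡-Reasoning

    outer-smaller : b ⟨ ∁ F ⟩ < Σᶠ n b
    outer-smaller = subst (b ⟨ ∁ F ⟩ <_) (sym (Σᶠ-split b F)) (m<n+m (b ⟨ ∁ F ⟩) b⟨F⟩>0)

    inner-hall : HallCondition a₁ b₁
    inner-hall F′ = begin
      b₁ ⟨ F′ ⟩          ≤⟨ ⟨⟩-mono b₁ F′ b (F′ ∩ F) (λ i∈F′ pos →
                              x∈p∩q⁺ (i∈F′ , restrict-pos⇒∈ F b pos) , restrict≤ F b _) ⟩
      b ⟨ F′ ∩ F ⟩       ≤⟨ hall (F′ ∩ F) ⟩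
      a ⟨ N (F′ ∩ F) ⟩   ≤⟨ ⟨⟩-mono a (N (F′ ∩ F)) a₁ (N F′) (λ i∈N _ →
                              N-mono (p∩q⊆p F′ F) i∈N ,
                              ≤-reflexive (sym (restrict-∈ a (N-mono (p∩q⊆q F′ F) i∈N)))) ⟩
      a₁ ⟨ N F′ ⟩        ∎
      where open ≤-Reasoning

    outer-hall : HallCondition a₂ b₂
    outer-hall F′ = +-cancelʳ-≤ (b ⟨ F ⟩) _ _ (begin
      b₂ ⟨ F′ ⟩ + b ⟨ F ⟩                ≤⟨ +-mono-≤ (⟨⟩-mono-⊆ b₂ {F′} (p⊆p∪q F)) b⟨F⟩≤b₁⟨G⟩ ⟩
      b₂ ⟨ G ⟩ + b₁ ⟨ G ⟩                ≡⟨ +-comm (b₂ ⟨ G ⟩) _ ⟩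
      b₁ ⟨ G ⟩ + b₂ ⟨ G ⟩                ≡⟨ ⟨⟩-split b F G ⟨
      b ⟨ G ⟩                            ≤⟨ hall G ⟩
      a ⟨ N G ⟩                          ≡⟨ ⟨⟩-split a (N F) (N G) ⟩
      a₁ ⟨ N G ⟩ + a₂ ⟨ N G ⟩            ≤⟨ +-mono-≤ a₁⟨NG⟩≤a⟨NF⟩ (⟨⟩-mono a₂ (N G) a₂ (N F′) outside) ⟩
      a ⟨ N F ⟩ + a₂ ⟨ N F′ ⟩            ≡⟨ +-comm (a ⟨ N F ⟩) _ ⟩
      a₂ ⟨ N F′ ⟩ + a ⟨ N F ⟩            ≡⟨ cong (a₂ ⟨ N F′ ⟩ +_) inner-balanced ⟩
      a₂ ⟨ N F′ ⟩ + b ⟨ F ⟩              ∎)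
      where
      open ≤-Reasoning
      G : Subset n
      G = F′ ∪ F

      b⟨F⟩≤b₁⟨G⟩ : b ⟨ F ⟩ ≤ b₁ ⟨ G ⟩
      b⟨F⟩≤b₁⟨G⟩ = ⟨⟩-mono b F b₁ G (λ i∈F _ → q⊆p∪q F′ F i∈F , ≤-reflexive (sym (restrict-∈ b i∈F)))

      a₁⟨NG⟩≤a⟨NF⟩ : a₁ ⟨ N G ⟩ ≤ a ⟨ N F ⟩
      a₁⟨NG⟩≤a⟨NF⟩ = ⟨⟩-mono a₁ (N G) a (N F) (λ _ pos → restrict-pos⇒∈ (N F) a pos , restrict≤ (N F) a _)

      outside : ∀ {i} → i ∈ N G → 0 < a₂ i → i ∈ N F′ × a₂ i ≤ a₂ i
      outside i∈NG pos with N-∪ i∈NG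
      ... | inj₁ i∈NF′ = i∈NF′ , ≤-refl
      ... | inj₂ i∈NF  = ⊥-elim (x∈∁p⇒x∉p (restrict-pos⇒∈ (∁ (N F)) a pos) i∈NF)

  supplied-neighbour : ∀ {a b} → HallCondition a b → ∀ {f} → 0 < b f → ∃ λ e → 0 < a e × R e f
  supplied-neighbour {a} {b} hall {f} b_f>0 with Σᶠ-pos n (restrict (N ⁅ f ⁆) a) a⟨N⁅f⁆⟩>0
    where
    a⟨N⁅f⁆⟩>0 : 0 < a ⟨ N ⁅ f ⁆ ⟩
    a⟨N⁅f⁆⟩>0 = begin
      1                  ≤⟨ b_f>0 ⟩
      b f                ≡⟨ restrict-∈ b (x∈⁅x⁆ f) ⟨
      restrict ⁅ f ⁆ b f ≤⟨ term≤Σᶠ n _ f ⟩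
      b ⟨ ⁅ f ⁆ ⟩        ≤⟨ hall ⁅ f ⁆ ⟩
      a ⟨ N ⁅ f ⁆ ⟩      ∎
      where open ≤-Reasoning
  ... | e , pos with ∈N⁻ (restrict-pos⇒∈ (N ⁅ f ⁆) a pos)
  ...   | f′ , f′∈⁅f⁆ , eRf′ = e , ≤-trans pos (restrict≤ (N ⁅ f ⁆) a e) , subst (R e) (x∈⁅y⁆⇒x≡y f f′∈⁅f⁆) eRf′

  peel-unit : ∀ {a b} → Smaller b → Σᶠ n a ≡ Σᶠ n b → HallCondition a b → 0 < Σᶠ n b →
              (∀ F → ¬ Critical a b F) → Transport a b
  peel-unit {a} {b} smaller balanced hall Σb>0 no-critical with Σᶠ-pos n b Σb>0
  ... | f , b_f>0 with supplied-neighbour hall b_f>0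
  ...   | e , aₑ>0 , eRf =
    transport-cast (∸χ+χ a aₑ>0) (∸χ+χ b b_f>0) (smaller Σb′<Σb balanced′ hall′ ⊕ transport-unit eRf)
    where
    a′ b′ : Fin n → ℕ
    a′ = a ∸χ e
    b′ = b ∸χ f

    balanced′ : Σᶠ n a′ ≡ Σᶠ n b′
    balanced′ = suc-injective (trans (Σᶠ-∸χ a aₑ>0) (trans balanced (sym (Σᶠ-∸χ b b_f>0))))

    Σb′<Σb : Σᶠ n b′ < Σᶠ n b
    Σb′<Σb = ≤-reflexive (Σᶠ-∸χ b b_f>0)

    b′⟨F⟩≤b⟨F⟩ : ∀ F → b′ ⟨ F ⟩ ≤ b ⟨ F ⟩
    b′⟨F⟩≤b⟨F⟩ F = ⟨⟩-mono b′ F b F (λ {i} i∈F _ → i∈F , m∸n≤m (b i) (χ f i))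

    hall′ : HallCondition a′ b′
    hall′ F with b ⟨ F ⟩ ≟ℕ 0 | b ⟨ F ⟩ <? Σᶠ n b
    ... | yes b⟨F⟩≡0 | _ = ≤-trans (b′⟨F⟩≤b⟨F⟩ F) (subst (_≤ a′ ⟨ N F ⟩) (sym b⟨F⟩≡0) z≤n)
    ... | no b⟨F⟩≢0 | yes b⟨F⟩<Σb = ≤-trans (b′⟨F⟩≤b⟨F⟩ F) (≤-pred (begin
      suc (b ⟨ F ⟩)            ≤⟨ ≰⇒> (λ le → no-critical F (n≢0⇒n>0 b⟨F⟩≢0 , b⟨F⟩<Σb , le)) ⟩
      a ⟨ N F ⟩                ≤⟨ ⟨⟩≤suc⟨⟩-∸χ a aₑ>0 (N F) ⟩
      suc (a′ ⟨ N F ⟩)         ∎))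
      where open ≤-Reasoning
    ... | no _ | no b⟨F⟩≮Σb = ≤-pred (begin
      suc (b′ ⟨ F ⟩)           ≤⟨ s≤s (subst (b′ ⟨ F ⟩ ≤_) (⟨⊤⟩ b′) (⟨⟩-mono-⊆ b′ {F} ⊆⊤)) ⟩
      suc (Σᶠ n b′)            ≡⟨ Σᶠ-∸χ b b_f>0 ⟩
      Σᶠ n b                   ≤⟨ ≮⇒≥ b⟨F⟩≮Σb ⟩
      b ⟨ F ⟩                  ≤⟨ hall F ⟩
      a ⟨ N F ⟩                ≤⟨ ⟨⟩≤suc⟨⟩-∸χ a aₑ>0 (N F) ⟩
      suc (a′ ⟨ N F ⟩)         ∎)
      where open ≤-Reasoning

  transport : ∀ a b → Σᶠ n a ≡ Σᶠ n b → HallCondition a b → Transport a b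
  transport a b = <-rec Goal step (Σᶠ n b) refl
    where
    Goal : ℕ → Set
    Goal k = ∀ {a b} → Σᶠ n b ≡ k → Σᶠ n a ≡ Σᶠ n b → HallCondition a b → Transport a b

    step : ∀ k → (∀ {j} → j < k → Goal j) → Goal k
    step _ rec {a} {b} refl balanced hall with Σᶠ n b ≟ℕ 0 | anySubset? (critical? a b)
    ... | yes Σb≡0 | _ = transport-zero (Σᶠ≡0⇒≡0 n a (trans balanced Σb≡0)) (Σᶠ≡0⇒≡0 n b Σb≡0)
    ... | no  _    | yes (F , critical) = split-at-critical (λ lt → rec lt refl) balanced hall critical
    ... | no  Σb≢0 | no  no-critical =
      peel-unit (λ lt → rec lt refl) balanced hall (n≢0⇒n>0 Σb≢0) (λ F c → no-critical (F , c))

UnitDecomposition : ∀ {n} k → (Fin n → ℕ) → Set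
UnitDecomposition {n} k m =
  ∃ λ (g : Fin k → Fin n) → (∀ i → 0 < m (g i)) × (∀ j → Σᶠ k (λ i → χ (g i) j) ≡ m j)

unit-decomposition : ∀ {n} k (m : Fin n → ℕ) → Σᶠ n m ≡ k → UnitDecomposition k m
unit-decomposition {n} zero    m Σm≡0 = (λ ()) , (λ ()) , λ j → sym (Σᶠ≡0⇒≡0 n m Σm≡0 j)
unit-decomposition {n} (suc k) m Σm≡1+k with Σᶠ-pos n m (subst (0 <_) (sym Σm≡1+k) z<s)
... | j₀ , mⱼ₀>0 = g , g-positive , g-sum
  where
  rest : UnitDecomposition k (m ∸χ j₀)
  rest = unit-decomposition k (m ∸χ j₀) (suc-injective (trans (Σᶠ-∸χ m mⱼ₀>0) Σm≡1+k))

  g : Fin (suc k) → Fin n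
  g zero    = j₀
  g (suc i) = proj₁ rest i

  g-positive : ∀ i → 0 < m (g i)
  g-positive zero    = mⱼ₀>0
  g-positive (suc i) = ≤-trans (proj₁ (proj₂ rest) i) (m∸n≤m _ (χ j₀ (g (suc i))))

  g-sum : ∀ j → Σᶠ (suc k) (λ i → χ (g i) j) ≡ m j
  g-sum j = begin
    χ j₀ j + Σᶠ k (λ i → χ (g (suc i)) j)  ≡⟨ cong (χ j₀ j +_) (proj₂ (proj₂ rest) j) ⟩
    χ j₀ j + (m ∸χ j₀) j                    ≡⟨ +-comm (χ j₀ j) _ ⟩
    (m ∸χ j₀) j + χ j₀ j                    ≡⟨ ∸χ+χ m mⱼ₀>0 j ⟩
    m j                                     ∎
    where open ≡-Reasoning

module _ {n : ℕ} (ρ : Subset n → ℕ) (z : Fin n → ℕ) where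

  violation? : Dec (∃ λ X → ρ X < z ⟨ X ⟩)
  violation? = anySubset? (λ X → ρ X <? z ⟨ X ⟩)

  no-violation⇒≤ρ : ¬ (∃ λ X → ρ X < z ⟨ X ⟩) → ∀ X → z ⟨ X ⟩ ≤ ρ X
  no-violation⇒≤ρ none X = ≮⇒≥ (λ ρX<z⟨X⟩ → none (X , ρX<z⟨X⟩))

  InBZ? : Dec (InBZ ρ z)
  InBZ? with z ⟨ ⊤ ⟩ ≟ℕ ρ ⊤ | violation?
  ... | no  z⟨⊤⟩≢ρ⊤ | _                  = no (z⟨⊤⟩≢ρ⊤ ∘ proj₂)
  ... | yes _       | yes (X , ρX<z⟨X⟩) = no (λ (z≤ρ , _) → <⇒≱ ρX<z⟨X⟩ (z≤ρ X))
  ... | yes z⟨⊤⟩≡ρ⊤ | no  none           = yes (no-violation⇒≤ρ none , z⟨⊤⟩≡ρ⊤)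

  violated-subset : z ⟨ ⊤ ⟩ ≡ ρ ⊤ → ¬ InBZ ρ z → ∃ λ X → ρ X < z ⟨ X ⟩
  violated-subset z⟨⊤⟩≡ρ⊤ z∉B with violation?
  ... | yes violated = violated
  ... | no  none     = ⊥-elim (z∉B (no-violation⇒≤ρ none , z⟨⊤⟩≡ρ⊤))

module Polymatroid {n : ℕ} (ρ : Subset n → ℕ) (submodular : Submodular ρ) (ρ⊥≡0 : ρ ⊥ ≡ 0)
                   (x : Fin n → ℕ) (x∈B : InBZ ρ x) where

  x≤ρ : ∀ X → x ⟨ X ⟩ ≤ ρ X
  x≤ρ = proj₁ x∈B

  Exchangeable : Fin n → Fin n → Set
  Exchangeable e f = InBZ ρ (exch x e f)

  open Transportation Exchangeable (λ e f → InBZ? ρ (exch x e f)) public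

  Tight : Subset n → Set
  Tight X = x ⟨ X ⟩ ≡ ρ X

  tight-⊥ : Tight ⊥
  tight-⊥ = trans (⟨⊥⟩ x) (sym ρ⊥≡0)

  tight-∪-∩ : ∀ {X Y} → Tight X → Tight Y → Tight (X ∪ Y) × Tight (X ∩ Y)
  tight-∪-∩ {X} {Y} tight-X tight-Y = +-≤-squeeze (x≤ρ (X ∪ Y)) (x≤ρ (X ∩ Y)) (begin
    ρ (X ∪ Y) + ρ (X ∩ Y)      ≤⟨ submodular X Y ⟩
    ρ X + ρ Y                  ≡⟨ cong₂ _+_ tight-X tight-Y ⟨
    x ⟨ X ⟩ + x ⟨ Y ⟩          ≡⟨ ⟨⟩-modular x X Y ⟨
    x ⟨ X ∪ Y ⟩ + x ⟨ X ∩ Y ⟩  ∎)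
    where open ≤-Reasoning

  separating-tight-set : ∀ {e f} → 1 ≤ x e → ¬ Exchangeable e f → ∃ λ X → Tight X × f ∈ X × e ∉ X
  separating-tight-set {e} {f} xₑ>0 ¬exchangeable with violated-subset ρ z z⟨⊤⟩≡ρ⊤ ¬exchangeable
    where
    z : Fin n → ℕ
    z = exch x e f
    z⟨⊤⟩≡ρ⊤ : z ⟨ ⊤ ⟩ ≡ ρ ⊤
    z⟨⊤⟩≡ρ⊤ = trans (+-cancelʳ-≡ 1 _ _ (subst₂ (λ s t → z ⟨ ⊤ ⟩ + s ≡ x ⟨ ⊤ ⟩ + t)
                       (χ⟨⟩-∈ e ∈⊤) (χ⟨⟩-∈ f ∈⊤) (exch-⟨⟩ x f xₑ>0 ⊤))) (proj₂ x∈B)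
  ... | X , ρX<z⟨X⟩ with e ∈? X | f ∈? X
  ...   | yes e∈X | _ = ⊥-elim (<⇒≱ ρX<z⟨X⟩ (+-cancelʳ-≤ 1 _ _ (begin
    exch x e f ⟨ X ⟩ + 1                  ≡⟨ cong (exch x e f ⟨ X ⟩ +_) (χ⟨⟩-∈ e e∈X) ⟨
    exch x e f ⟨ X ⟩ + χ e ⟨ X ⟩          ≡⟨ exch-⟨⟩ x f xₑ>0 X ⟩
    x ⟨ X ⟩ + χ f ⟨ X ⟩                   ≤⟨ +-mono-≤ (x≤ρ X) (χ⟨⟩≤1 f X) ⟩
    ρ X + 1                               ∎)))
    where open ≤-Reasoning
  ...   | no e∉X  | no f∉X = ⊥-elim (<⇒≱ ρX<z⟨X⟩ (begin
    exch x e f ⟨ X ⟩                      ≡⟨ +-cancelʳ-≡ 0 _ _ (subst₂ (λ s t → exch x e f ⟨ X ⟩ + s ≡ x ⟨ X ⟩ + t)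
                                               (χ⟨⟩-∉ e e∉X) (χ⟨⟩-∉ f f∉X) (exch-⟨⟩ x f xₑ>0 X)) ⟩
    x ⟨ X ⟩                               ≤⟨ x≤ρ X ⟩
    ρ X                                   ∎))
    where open ≤-Reasoning
  ...   | no e∉X  | yes f∈X = X , ≤-antisym (x≤ρ X) (≤-pred (begin
    suc (ρ X)                             ≤⟨ ρX<z⟨X⟩ ⟩
    exch x e f ⟨ X ⟩                      ≡⟨ +-identityʳ _ ⟨
    exch x e f ⟨ X ⟩ + 0                  ≡⟨ subst₂ (λ s t → exch x e f ⟨ X ⟩ + s ≡ x ⟨ X ⟩ + t)
                                               (χ⟨⟩-∉ e e∉X) (χ⟨⟩-∈ f f∈X) (exch-⟨⟩ x f xₑ>0 X) ⟩
    x ⟨ X ⟩ + 1                           ≡⟨ +-comm _ 1 ⟩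
    suc (x ⟨ X ⟩)                         ∎)) , f∈X , e∉X
    where open ≤-Reasoning

  tight-cover : ∀ F → ∃ λ T → Tight T × F ⊆ T × (∀ {i} → i ∈ T → 0 < x i → i ∈ N F)
  tight-cover F =
    let T , (tight-T , T-avoids) , F⊆T = ∪-closed-covering {P = λ X → Tight X × Avoiding X} F
          (tight-⊥ , λ _ → ∉⊥)
          (λ {X} {Y} (tight-X , X-avoids) (tight-Y , Y-avoids) → proj₁ (tight-∪-∩ tight-X tight-Y) ,
             λ outside i∈X∪Y → [ X-avoids outside , Y-avoids outside ] (x∈p∪q⁻ X Y i∈X∪Y))
          tight-avoiding-through
    in T , tight-T , F⊆T , λ {i} i∈T xᵢ>0 →
         decidable-stable (i ∈? N F) (λ i∉NF → T-avoids (xᵢ>0 , i∉NF) i∈T)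
    where
    Outside : Fin n → Set
    Outside e = 1 ≤ x e × e ∉ N F

    Avoiding : Subset n → Set
    Avoiding X = ∀ {e} → Outside e → e ∉ X

    tight-avoiding-through : ∀ {f} → f ∈ F → ∃ λ X → (Tight X × Avoiding X) × f ∈ X
    tight-avoiding-through {f} f∈F =
      let X , (tight-X , f∈X) , avoids = ∩-closed-avoiding {P = λ X → Tight X × f ∈ X}
            (λ e → (1 ≤? x e) ×-dec ¬? (e ∈? N F))
            (proj₂ x∈B , ∈⊤)
            (λ (tight-X , f∈X) (tight-Y , f∈Y) → proj₂ (tight-∪-∩ tight-X tight-Y) , x∈p∩q⁺ (f∈X , f∈Y))
            (λ (xₑ>0 , e∉NF) → let X , tight-X , f∈X , e∉X = separating-tight-set xₑ>0 (e∉NF ∘ ∈N⁺ f∈F)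
                                in X , (tight-X , f∈X) , e∉X)
      in X , (tight-X , avoids) , f∈X

  hall-condition : ∀ y → (∀ X → y ⟨ X ⟩ ≤ ρ X) → HallCondition x y
  hall-condition y y≤ρ F = let T , tight-T , F⊆T , T⊆NF = tight-cover F in begin
    y ⟨ F ⟩    ≤⟨ ⟨⟩-mono-⊆ y F⊆T ⟩
    y ⟨ T ⟩    ≤⟨ y≤ρ T ⟩
    ρ T        ≡⟨ tight-T ⟨
    x ⟨ T ⟩    ≤⟨ ⟨⟩-mono x T x (N F) (λ i∈T xᵢ>0 → T⊆NF i∈T xᵢ>0 , ≤-refl) ⟩
    x ⟨ N F ⟩  ∎
    where open ≤-Reasoning

lemma2 : (n : ℕ) (ρ : Subset n → ℕ) → Monotone ρ → Submodular ρ → ρ ⊥ ≡ 0 →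
    (x y : Fin n → ℕ) → InBZ ρ x → InBZ ρ y →
    Σ ((e : Fin n) → Fin (x e) → Fin n) λ φ →
      (∀ e i → 0 < y (φ e i)) ×
      (∀ e i → InBZ ρ (exch x e (φ e i))) ×
      (∀ k → y k ≡ Σᶠ n (λ e → Σᶠ (x e) (λ i → χ (φ e i) k)))
lemma2 n ρ _ submodular ρ⊥≡0 x y x∈B (y≤ρ , y⟨⊤⟩≡ρ⊤) = φ , φ-positive , φ-exchangeable , y-decomposed
  where
  open Polymatroid ρ submodular ρ⊥≡0 x x∈B

  balanced : Σᶠ n x ≡ Σᶠ n y
  balanced = trans (sym (⟨⊤⟩ x)) (trans (proj₂ x∈B) (trans (sym y⟨⊤⟩≡ρ⊤) (⟨⊤⟩ y)))

  open Transport (transport x y balanced (hall-condition y y≤ρ))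

  row : ∀ e → UnitDecomposition (x e) (M e)
  row e = unit-decomposition (x e) (M e) (row-sum e)

  φ : (e : Fin n) → Fin (x e) → Fin n
  φ e = proj₁ (row e)

  M>0 : ∀ e i → 0 < M e (φ e i)
  M>0 e = proj₁ (proj₂ (row e))

  φ-positive : ∀ e i → 0 < y (φ e i)
  φ-positive e i = ≤-trans (M>0 e i) (subst (M e (φ e i) ≤_) (column-sum (φ e i)) (term≤Σᶠ n _ e))

  φ-exchangeable : ∀ e i → InBZ ρ (exch x e (φ e i))
  φ-exchangeable e i = supported e (φ e i) (M>0 e i)

  y-decomposed : ∀ k → y k ≡ Σᶠ n (λ e → Σᶠ (x e) (λ i → χ (φ e i) k))
  y-decomposed k = trans (sym (column-sum k)) (Σᶠ-cong n (λ e → sym (proj₂ (proj₂ (row e)) k)))
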